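{- Let $G$ be a finite abelian group, $p\geq2$ an even integer, $B_1,B_2\subseteq G$ nonempty, and $\mu=\mu_{B_1}\circ\mu_{B_2}$. Let $A\subseteq G$ have density $\alpha>0$ and let $f:G\to\mathbb{R}_{\geq0}$. Then there exist $A_1\subseteq B_1$ and $A_2\subseteq B_2$ such that \[\langle\mu_{A_1}\circ\mu_{A_2},f\rangle\leq 2\frac{\langle(\mu_A\circ\mu_A)^p,f\rangle_\mu}{\lVert\mu_A\circ\mu_A\rVert_{p(\mu)}^p}\] and \[\min\left(\mu_{B_1}(A_1),\mu_{B_2}(A_2)\right)\geq\tfrac14\alpha^{2p}\lVert\mu_A\circ\mu_A\rVert_{p(\mu)}^{2p}.\]
   Context: For $X\subseteq G$: $\mu(X)=\lvert X\rvert/\lvert G\rvert$, $\mu_Y(X)=\lvert X\cap Y\rvert/\lvert Y\rvert$, $\mu_X=1_X/\mu(X)$. $f\circ g(x)=\mathbb{E}_{y\in G}f(y)g(x+y)$; $\langle f,g\rangle=\mathbb{E}_{x\in G}f(x)\overline{g(x)}$; for nonnegative $\nu$ with $\mathbb{E}\nu=1$, $\langle f,g\rangle_\nu=\mathbb{E}_{x\in G}\nu(x)f(x)\overline{g(x)}$ and $\lVert f\rVert_{p(\nu)}=(\mathbb{E}_{x\in G}\nu(x)\lvert f(x)\rvert^p)^{1/p}$.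
   Formalization: The function f takes nonnegative rational values rather than nonnegative real ones. -}

module Defs where

open import Data.Nat as ℕ using (ℕ; zero; suc)
open import Data.Integer using (+_; -[1+_])
open import Data.Fin using (Fin) renaming (zero to fzero; suc to fsuc)
open import Data.Product using (Σ)
open import Data.Bool using (_∧_)
open import Data.Rational using (∣_∣)
open import Data.Bool using (Bool; true; false; if_then_else_)
open import Data.Rational using (ℚ; mkℚ; 0ℚ; 1ℚ; _+_; _*_; _/_; 1/_)
open import Algebra.Structures using (IsAbelianGroup)
open import Function.Bundles using (_↔_; Inverse)
open import Relation.Binary.PropositionalEquality using (_≡_)

record FiniteAbelianGroup : Set₁ where
  field
    Carrier  : Set
    _⊕_      : Carrier → Carrier → Carrier
    ε        : Carrier
    ⊖_       : Carrier → Carrier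
    isAbelianGroup : IsAbelianGroup _≡_ _⊕_ ε ⊖_
    size     : ℕ
    enum     : Fin size ↔ Carrier

  elem : Fin size → Carrier
  elem = Inverse.to enum

  sizeNZ : ℕ.NonZero size
  sizeNZ = nz (Inverse.from enum ε)
    where
    nz : ∀ {n} → Fin n → ℕ.NonZero n
    nz {suc n} _ = _

sumFin : (n : ℕ) → (Fin n → ℚ) → ℚ
sumFin zero    f = 0ℚ
sumFin (suc n) f = f fzero + sumFin n (λ i → f (fsuc i))

_^_ : ℚ → ℕ → ℚ
q ^ zero  = 1ℚ
q ^ suc n = q * (q ^ n)

-- reciprocal with the convention 1/0 = 0
inv : ℚ → ℚ
inv (mkℚ (+ zero)    d c) = 0ℚ
inv (mkℚ (+ suc n)   d c) = 1/ mkℚ (+ suc n) d c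
inv (mkℚ -[1+ n ]    d c) = 1/ mkℚ -[1+ n ] d c

module _ (G : FiniteAbelianGroup) where
  open FiniteAbelianGroup G

  Subset : Set
  Subset = Carrier → Bool

  _⊆_ : Subset → Subset → Set
  X ⊆ Y = ∀ x → X x ≡ true → Y x ≡ true

  Nonempty : Subset → Set
  Nonempty X = Σ Carrier (λ x → X x ≡ true)

  𝔼 : (Carrier → ℚ) → ℚ
  𝔼 f = sumFin size (λ i → f (elem i)) * ((+ 1) / size)
    where instance _ = sizeNZ

  𝟙 : Subset → Carrier → ℚ
  𝟙 X x = if X x then 1ℚ else 0ℚ

  μ : Subset → ℚ
  μ X = 𝔼 (𝟙 X)

  -- μ_Y(X) = |X ∩ Y| / |Y|  (= 0 if Y = ∅ by convention)
  μ[_] : Subset → Subset → ℚ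
  μ[ Y ] X = μ (λ x → X x ∧ Y x) * inv (μ Y)

  -- μ_X = 1_X / μ(X)  (= 0 if X = ∅ by convention)
  bal : Subset → Carrier → ℚ
  bal X x = 𝟙 X x * inv (μ X)

  _∘ᶜ_ : (Carrier → ℚ) → (Carrier → ℚ) → Carrier → ℚ
  (f ∘ᶜ g) x = 𝔼 (λ y → f y * g (x ⊕ y))

  ⟪_,_⟫ : (Carrier → ℚ) → (Carrier → ℚ) → ℚ
  ⟪ f , g ⟫ = 𝔼 (λ x → f x * g x)

  ⟪_,_⟫[_] : (Carrier → ℚ) → (Carrier → ℚ) → (Carrier → ℚ) → ℚ
  ⟪ f , g ⟫[ ν ] = 𝔼 (λ x → ν x * f x * g x)

  normPow : ℕ → (Carrier → ℚ) → (Carrier → ℚ) → ℚ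
  normPow p ν f = 𝔼 (λ x → ν x * (∣ f x ∣ ^ p))

{-# OPTIONS --safe #-}
module Submission where

-- Dependent random choice. For s ∈ Gᵖ let Aⱼ(s) = Bⱼ ∩ (A − s₁) ∩ ⋯ ∩ (A − sₚ). Averaging over a
-- uniform s, 𝔼ₛ ⟨1_{A₁(s)} ∘ 1_{A₂(s)}, f⟩ = ⟨(1_{B₁} ∘ 1_{B₂}) (1_A ∘ 1_A)ᵖ, f⟩ = K ⟨gᵖ, f⟩_μ and
-- 𝔼ₛ μ(A₁(s)) μ(A₂(s)) = K ‖g‖ᵖ, where g = μ_A ∘ μ_A and K = μ(B₁) μ(B₂) α²ᵖ. As 𝔼ₛ μ(Aⱼ(s)) = μ(Bⱼ) αᵖ
-- and αᵖ ‖g‖ᵖ ≤ 1 (because g ≤ 1/α), the choices with μ_{Bⱼ}(Aⱼ(s)) below the threshold carry at most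
-- half of the second mean. Restricted to the remaining choices, the first mean is still at most
-- 2 ⟨gᵖ, f⟩_μ / ‖g‖ᵖ times the second, so some remaining s has ⟨1_{A₁(s)} ∘ 1_{A₂(s)}, f⟩ at most that
-- multiple of μ(A₁(s)) μ(A₂(s)); normalizing gives the first bound.

open import Defs
open import Data.Nat using (ℕ)
open import Data.Rational using (ℚ; 0ℚ)
import Data.Rational as Q

module RationalLemmas where
  open import Data.Nat as ℕ using (ℕ; zero; suc)
  import Data.Nat.Properties as ℕₚ
  open import Data.Integer using (+_; -[1+_])
  open import Data.Rational
  open import Data.Rational.Properties
  open import Data.Rational.Solver using (module +-*-Solver)
  open import Data.Empty using (⊥-elim)
  open import Relation.Binary.PropositionalEquality
  open +-*-Solver using (solve; _:+_; _:*_; _:=_)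

  0≤1 : 0ℚ ≤ 1ℚ
  0≤1 = nonNegative⁻¹ 1ℚ

  *-nonNeg : ∀ {p q} → 0ℚ ≤ p → 0ℚ ≤ q → 0ℚ ≤ p * q
  *-nonNeg {p} {q} 0≤p 0≤q =
    nonNegative⁻¹ _ {{nonNeg*nonNeg⇒nonNeg p {{nonNegative 0≤p}} q {{nonNegative 0≤q}}}}

  *-pos : ∀ {p q} → 0ℚ < p → 0ℚ < q → 0ℚ < p * q
  *-pos {p} {q} 0<p 0<q = positive⁻¹ _ {{pos*pos⇒pos p {{positive 0<p}} q {{positive 0<q}}}}

  *-monoˡ-≤ : ∀ {r p q} → 0ℚ ≤ r → p ≤ q → r * p ≤ r * q
  *-monoˡ-≤ {r} 0≤r = *-monoˡ-≤-nonNeg r {{nonNegative 0≤r}}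

  *-monoʳ-≤ : ∀ {r p q} → 0ℚ ≤ r → p ≤ q → p * r ≤ q * r
  *-monoʳ-≤ {r} 0≤r = *-monoʳ-≤-nonNeg r {{nonNegative 0≤r}}

  +-cancel-≤ : ∀ {a b c d} → a + b ≤ c + d → c ≤ a → b ≤ d
  +-cancel-≤ a+b≤c+d c≤a = ≮⇒≥ λ d<b → <-irrefl refl (<-≤-trans (+-mono-≤-< c≤a d<b) a+b≤c+d)

  +-cancel-< : ∀ {a b c d} → a + b ≤ c + d → c < a → b < d
  +-cancel-< a+b≤c+d c<a = ≰⇒> λ d≤b → <-irrefl refl (<-≤-trans (+-mono-<-≤ c<a d≤b) a+b≤c+d)

  p≤p+q : ∀ {p q} → 0ℚ ≤ q → p ≤ p + q
  p≤p+q {p} 0≤q = ≤-trans (≤-reflexive (sym (+-identityʳ p))) (+-monoʳ-≤ p 0≤q)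

  p≤q+p : ∀ {p q} → 0ℚ ≤ q → p ≤ q + p
  p≤q+p {p} {q} 0≤q = ≤-trans (p≤p+q 0≤q) (≤-reflexive (+-comm p q))

  +-interchange : ∀ a b c d → (a + b) + (c + d) ≡ (a + c) + (b + d)
  +-interchange = solve 4 (λ a b c d → (a :+ b) :+ (c :+ d) := (a :+ c) :+ (b :+ d)) refl

  *-interchange : ∀ a b c d → (a * b) * (c * d) ≡ (a * c) * (b * d)
  *-interchange = solve 4 (λ a b c d → (a :* b) :* (c :* d) := (a :* c) :* (b :* d)) refl

  inv-nonNeg : ∀ {q} → 0ℚ ≤ q → 0ℚ ≤ inv q
  inv-nonNeg {mkℚ (+ zero) _ _}    _        = ≤-refl
  inv-nonNeg {q@(mkℚ (+ suc _) _ _)} _      = <⇒≤ (positive⁻¹ _ {{1/pos⇒pos q}})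
  inv-nonNeg {mkℚ -[1+ _ ] _ _}    (*≤* ())

  *-inv : ∀ {q} → q ≢ 0ℚ → q * inv q ≡ 1ℚ
  *-inv {mkℚ (+ zero) _ _}    q≢0 = ⊥-elim (q≢0 (↥p≡0⇒p≡0 _ refl))
  *-inv {q@(mkℚ (+ suc _) _ _)} _ = *-inverseʳ q
  *-inv {q@(mkℚ -[1+ _ ] _ _)}  _ = *-inverseʳ q

  ^-nonNeg : ∀ {q} n → 0ℚ ≤ q → 0ℚ ≤ q ^ n
  ^-nonNeg zero    _   = 0≤1
  ^-nonNeg (suc n) 0≤q = *-nonNeg 0≤q (^-nonNeg n 0≤q)

  ^-pos : ∀ {q} n → 0ℚ < q → 0ℚ < q ^ n
  ^-pos zero    _   = positive⁻¹ 1ℚ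
  ^-pos (suc n) 0<q = *-pos 0<q (^-pos n 0<q)

  ^-≤-1 : ∀ {q} n → 0ℚ ≤ q → q ≤ 1ℚ → q ^ n ≤ 1ℚ
  ^-≤-1 zero    _   _   = ≤-refl
  ^-≤-1 {q} (suc n) 0≤q q≤1 = begin
    q * q ^ n   ≤⟨ *-monoʳ-≤ (^-nonNeg n 0≤q) q≤1 ⟩
    1ℚ * q ^ n  ≡⟨ *-identityˡ (q ^ n) ⟩
    q ^ n       ≤⟨ ^-≤-1 n 0≤q q≤1 ⟩
    1ℚ          ∎
    where open ≤-Reasoning

  ^-distrib-* : ∀ p q n → (p * q) ^ n ≡ p ^ n * q ^ n
  ^-distrib-* p q zero    = refl
  ^-distrib-* p q (suc n) =
    trans (cong (p * q *_) (^-distrib-* p q n)) (*-interchange p q (p ^ n) (q ^ n))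

  ^-homo-+ : ∀ q m n → q ^ (m ℕ.+ n) ≡ q ^ m * q ^ n
  ^-homo-+ q zero    n = sym (*-identityˡ _)
  ^-homo-+ q (suc m) n = trans (cong (q *_) (^-homo-+ q m n)) (sym (*-assoc q _ _))

  ^-double : ∀ q n → q ^ (2 ℕ.* n) ≡ (q * q) ^ n
  ^-double q n = begin
    q ^ (n ℕ.+ (n ℕ.+ 0)) ≡⟨ cong (λ m → q ^ (n ℕ.+ m)) (ℕₚ.+-identityʳ n) ⟩
    q ^ (n ℕ.+ n)         ≡⟨ ^-homo-+ q n n ⟩
    q ^ n * q ^ n         ≡⟨ ^-distrib-* q q n ⟨
    (q * q) ^ n           ∎
    where open ≡-Reasoning

module FiniteSums where
  open import Data.Nat using (ℕ; zero; suc)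
  open import Data.Fin using (Fin; zero; suc)
  open import Data.Product using (∃; _×_; _,_)
  open import Data.Rational
  open import Data.Rational.Properties
  open import Data.Empty using (⊥-elim)
  open import Function using (_∘_)
  open import Relation.Binary.PropositionalEquality
  open import Relation.Nullary using (Dec; yes; no)
  import Algebra.Properties.CommutativeMonoid.Sum +-0-commutativeMonoid as Σ
  open RationalLemmas

  sumFin-cong : ∀ n {h k : Fin n → ℚ} → h ≗ k → sumFin n h ≡ sumFin n k
  sumFin-cong zero    h≗k = refl
  sumFin-cong (suc n) h≗k = cong₂ _+_ (h≗k zero) (sumFin-cong n (h≗k ∘ suc))

  sumFin-+ : ∀ n (h k : Fin n → ℚ) → sumFin n (λ i → h i + k i) ≡ sumFin n h + sumFin n k
  sumFin-+ zero    h k = refl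
  sumFin-+ (suc n) h k = trans (cong (h zero + k zero +_) (sumFin-+ n (h ∘ suc) (k ∘ suc)))
                               (+-interchange (h zero) (k zero) _ _)

  sumFin-*ˡ : ∀ n c (h : Fin n → ℚ) → sumFin n (λ i → c * h i) ≡ c * sumFin n h
  sumFin-*ˡ zero    c h = sym (*-zeroʳ c)
  sumFin-*ˡ (suc n) c h = trans (cong (c * h zero +_) (sumFin-*ˡ n c (h ∘ suc)))
                                (sym (*-distribˡ-+ c _ _))

  sumFin-comm : ∀ m n (h : Fin m → Fin n → ℚ) →
                sumFin m (λ i → sumFin n (h i)) ≡ sumFin n (λ j → sumFin m (λ i → h i j))
  sumFin-comm zero    n h = trans (sym (*-zeroˡ (sumFin n (λ _ → 0ℚ)))) (sym (sumFin-*ˡ n 0ℚ (λ _ → 0ℚ)))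
  sumFin-comm (suc m) n h = trans (cong (sumFin n (h zero) +_) (sumFin-comm m n (h ∘ suc)))
                                  (sym (sumFin-+ n (h zero) _))

  sumFin-mono : ∀ n {h k : Fin n → ℚ} → (∀ i → h i ≤ k i) → sumFin n h ≤ sumFin n k
  sumFin-mono zero    h≤k = ≤-refl
  sumFin-mono (suc n) h≤k = +-mono-≤ (h≤k zero) (sumFin-mono n (h≤k ∘ suc))

  sumFin-nonNeg : ∀ n {h : Fin n → ℚ} → (∀ i → 0ℚ ≤ h i) → 0ℚ ≤ sumFin n h
  sumFin-nonNeg zero    0≤h = ≤-refl
  sumFin-nonNeg (suc n) 0≤h = +-mono-≤ (0≤h zero) (sumFin-nonNeg n (0≤h ∘ suc))

  sumFin-pos : ∀ n {h : Fin n → ℚ} → (∀ i → 0ℚ ≤ h i) → ∀ i → 0ℚ < h i → 0ℚ < sumFin n h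
  sumFin-pos (suc n) 0≤h zero    0<h₀ = +-mono-<-≤ 0<h₀ (sumFin-nonNeg n (0≤h ∘ suc))
  sumFin-pos (suc n) 0≤h (suc i) 0<hᵢ = +-mono-≤-< (0≤h zero) (sumFin-pos n (0≤h ∘ suc) i 0<hᵢ)

  sumFin-witness : ∀ n {c} (u w : Fin n → ℚ) → 0ℚ ≤ c → (∀ i → 0ℚ ≤ u i) →
                   0ℚ < sumFin n w → sumFin n u ≤ c * sumFin n w →
                   ∃ λ i → 0ℚ < w i × u i ≤ c * w i
  sumFin-witness zero    u w _ _ 0<Σw _ = ⊥-elim (<-irrefl refl 0<Σw)
  sumFin-witness (suc n) {c} u w 0≤c 0≤u 0<Σw Σu≤cΣw =
    decide (0ℚ <? w zero) (u zero ≤? c * w zero)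
    where
    Σu≤cΣw′ : u zero + sumFin n (u ∘ suc) ≤ c * w zero + c * sumFin n (w ∘ suc)
    Σu≤cΣw′ = ≤-trans Σu≤cΣw (≤-reflexive (*-distribˡ-+ c _ _))

    inTail : sumFin n (u ∘ suc) ≤ c * sumFin n (w ∘ suc) → 0ℚ < sumFin n (w ∘ suc) →
             ∃ λ i → 0ℚ < w i × u i ≤ c * w i
    inTail U≤cW 0<W =
      let i , found = sumFin-witness n (u ∘ suc) (w ∘ suc) 0≤c (0≤u ∘ suc) 0<W U≤cW in suc i , found

    decide : Dec (0ℚ < w zero) → Dec (u zero ≤ c * w zero) → ∃ λ i → 0ℚ < w i × u i ≤ c * w i
    decide (yes 0<w₀) (yes u₀≤cw₀) = zero , 0<w₀ , u₀≤cw₀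
    decide (no 0≮w₀)  _            = inTail (+-cancel-≤ Σu≤cΣw′ cw₀≤u₀) 0<W
      where
      w₀≤0 = ≮⇒≥ 0≮w₀
      cw₀≤u₀ = ≤-trans (*-monoˡ-≤ 0≤c w₀≤0) (≤-trans (≤-reflexive (*-zeroʳ c)) (0≤u zero))
      0<W = ≰⇒> λ W≤0 → <-irrefl refl (<-≤-trans 0<Σw (+-mono-≤ w₀≤0 W≤0))
    decide (yes _)    (no u₀≰cw₀)  = inTail (<⇒≤ U<cW) 0<W
      where
      U<cW = +-cancel-< Σu≤cΣw′ (≰⇒> u₀≰cw₀)
      0<W = ≰⇒> λ W≤0 → <-irrefl refl (<-≤-trans (≤-<-trans (sumFin-nonNeg n (0≤u ∘ suc)) U<cW)
                                        (≤-trans (*-monoˡ-≤ 0≤c W≤0) (≤-reflexive (*-zeroʳ c))))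

  sumFin≡sum : ∀ n (h : Fin n → ℚ) → sumFin n h ≡ Σ.sum h
  sumFin≡sum zero    h = refl
  sumFin≡sum (suc n) h = cong (h zero +_) (sumFin≡sum n (h ∘ suc))

module Expectation (G : FiniteAbelianGroup) where
  open import Data.Fin.Permutation using (Permutation′)
  open import Data.Integer using (+_)
  open import Data.Product using (∃; _×_; _,_)
  open import Data.Rational
  open import Data.Rational.Properties
  open import Function using (_∘_; Inverse)
  open import Relation.Binary.PropositionalEquality
  open import Function.Bundles using (_↔_; mk↔ₛ′)
  open import Function.Construct.Composition using (_↔-∘_)
  open import Function.Construct.Symmetry using (↔-sym)
  open import Level using (0ℓ)
  open import Algebra.Bundles using (Group)
  open import Algebra.Structures using (IsAbelianGroup)
  import Algebra.Properties.Group
  import Algebra.Properties.CommutativeMonoid.Sum +-0-commutativeMonoid as Σ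
  open RationalLemmas
  open FiniteSums
  open FiniteAbelianGroup G

  private
    κ : ℚ
    κ = (+ 1 / size) {{sizeNZ}}

    0<κ : 0ℚ < κ
    0<κ = positive⁻¹ κ {{normalize-pos 1 size {{sizeNZ}}}}

  𝔼-cong : ∀ {h k : Carrier → ℚ} → h ≗ k → 𝔼 G h ≡ 𝔼 G k
  𝔼-cong h≗k = cong (_* κ) (sumFin-cong size (h≗k ∘ elem))

  𝔼-+ : ∀ (h k : Carrier → ℚ) → 𝔼 G (λ x → h x + k x) ≡ 𝔼 G h + 𝔼 G k
  𝔼-+ h k = trans (cong (_* κ) (sumFin-+ size (h ∘ elem) (k ∘ elem)))
                  (*-distribʳ-+ κ (sumFin size (h ∘ elem)) (sumFin size (k ∘ elem)))

  𝔼-*ˡ : ∀ c (h : Carrier → ℚ) → 𝔼 G (λ x → c * h x) ≡ c * 𝔼 G h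
  𝔼-*ˡ c h = trans (cong (_* κ) (sumFin-*ˡ size c (h ∘ elem))) (*-assoc c _ κ)

  𝔼-*ʳ : ∀ c (h : Carrier → ℚ) → 𝔼 G (λ x → h x * c) ≡ 𝔼 G h * c
  𝔼-*ʳ c h = trans (𝔼-cong (λ x → *-comm (h x) c)) (trans (𝔼-*ˡ c h) (*-comm c _))

  𝔼-0 : 𝔼 G (λ _ → 0ℚ) ≡ 0ℚ
  𝔼-0 = trans (𝔼-*ˡ 0ℚ (λ _ → 0ℚ)) (*-zeroˡ (𝔼 G (λ _ → 0ℚ)))

  𝔼-mono : ∀ {h k : Carrier → ℚ} → (∀ x → h x ≤ k x) → 𝔼 G h ≤ 𝔼 G k
  𝔼-mono h≤k = *-monoʳ-≤ (<⇒≤ 0<κ) (sumFin-mono size (h≤k ∘ elem))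

  𝔼-nonNeg : ∀ {h : Carrier → ℚ} → (∀ x → 0ℚ ≤ h x) → 0ℚ ≤ 𝔼 G h
  𝔼-nonNeg 0≤h = *-nonNeg (sumFin-nonNeg size (0≤h ∘ elem)) (<⇒≤ 0<κ)

  𝔼-pos : ∀ {h : Carrier → ℚ} → (∀ x → 0ℚ ≤ h x) → ∀ x → 0ℚ < h x → 0ℚ < 𝔼 G h
  𝔼-pos {h} 0≤h x 0<hx = *-pos (sumFin-pos size (0≤h ∘ elem) (Inverse.from enum x) 0<h[x]) 0<κ
    where 0<h[x] = subst (λ y → 0ℚ < h y) (sym (Inverse.strictlyInverseˡ enum x)) 0<hx

  𝔼-comm : ∀ (h : Carrier → Carrier → ℚ) →
           𝔼 G (λ x → 𝔼 G (h x)) ≡ 𝔼 G (λ y → 𝔼 G (λ x → h x y))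
  𝔼-comm h = cong (_* κ) (begin
    sumFin size (λ i → Σh (elem i) * κ)   ≡⟨ sumFin-cong size (λ i → *-comm (Σh (elem i)) κ) ⟩
    sumFin size (λ i → κ * Σh (elem i))   ≡⟨ sumFin-*ˡ size κ _ ⟩
    κ * sumFin size (Σh ∘ elem)           ≡⟨ cong (κ *_) (sumFin-comm size size _) ⟩
    κ * sumFin size (Σh′ ∘ elem)          ≡⟨ sumFin-*ˡ size κ _ ⟨
    sumFin size (λ j → κ * Σh′ (elem j))  ≡⟨ sumFin-cong size (λ j → *-comm κ (Σh′ (elem j))) ⟩
    sumFin size (λ j → Σh′ (elem j) * κ)  ∎)
    where
    open ≡-Reasoning
    Σh Σh′ : Carrier → ℚ
    Σh  x = sumFin size (h x ∘ elem)
    Σh′ y = sumFin size (λ i → h (elem i) y)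

  private
    group : Group 0ℓ 0ℓ
    group = record { isGroup = IsAbelianGroup.isGroup isAbelianGroup }

    translation : Carrier → Permutation′ size
    translation x = ↔-sym enum ↔-∘ (x⊕ ↔-∘ enum)
      where
      open Algebra.Properties.Group group using (\\-leftDividesˡ; \\-leftDividesʳ)
      x⊕ : Carrier ↔ Carrier
      x⊕ = mk↔ₛ′ (x ⊕_) ((⊖ x) ⊕_) (\\-leftDividesˡ x) (\\-leftDividesʳ x)

  𝔼-translate : ∀ x (h : Carrier → ℚ) → 𝔼 G (λ y → h (x ⊕ y)) ≡ 𝔼 G h
  𝔼-translate x h = cong (_* κ) (begin
    sumFin size (λ i → h (x ⊕ elem i))      ≡⟨ sumFin-cong size (λ i → cong h (sym (strictlyInverseˡ _))) ⟩
    sumFin size (λ i → h (elem (π i)))      ≡⟨ sumFin≡sum size _ ⟩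
    Σ.sum (λ i → h (elem (π i)))            ≡⟨ Σ.sum-permute (h ∘ elem) (translation x) ⟨
    Σ.sum (h ∘ elem)                        ≡⟨ sumFin≡sum size _ ⟨
    sumFin size (h ∘ elem)                  ∎)
    where
    open ≡-Reasoning
    open Inverse enum using (from; strictlyInverseˡ)
    π = λ i → from (x ⊕ elem i)

  𝔼-witness : ∀ {c} (u w : Carrier → ℚ) → 0ℚ ≤ c → (∀ x → 0ℚ ≤ u x) →
              0ℚ < 𝔼 G w → 𝔼 G u ≤ c * 𝔼 G w → ∃ λ x → 0ℚ < w x × u x ≤ c * w x
  𝔼-witness {c} u w 0≤c 0≤u 0<𝔼w 𝔼u≤c𝔼w =
    let i , found = sumFin-witness size (u ∘ elem) (w ∘ elem) 0≤c (0≤u ∘ elem) 0<Σw Σu≤cΣw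
    in elem i , found
    where
    0<Σw = *-cancelʳ-<-nonNeg κ {{nonNegative (<⇒≤ 0<κ)}} (subst (_< 𝔼 G w) (sym (*-zeroˡ κ)) 0<𝔼w)
    Σu≤cΣw = *-cancelʳ-≤-pos κ {{positive 0<κ}} (subst (𝔼 G u ≤_) (sym (*-assoc c _ κ)) 𝔼u≤c𝔼w)

module Densities (G : FiniteAbelianGroup) where
  open import Data.Bool using (true; false; _∧_; if_then_else_)
  open import Data.Product using (_,_)
  open import Data.Rational
  open import Data.Rational.Properties
  open import Data.Rational.Solver using (module +-*-Solver)
  open import Relation.Binary.PropositionalEquality
  open import Algebra.Structures using (IsAbelianGroup)
  open +-*-Solver using (solve; _:*_; _:=_)
  open RationalLemmas
  open Expectation G
  open FiniteAbelianGroup G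
  open IsAbelianGroup isAbelianGroup using (comm)

  𝟙-nonNeg : ∀ X x → 0ℚ ≤ 𝟙 G X x
  𝟙-nonNeg X x with X x
  ... | true  = 0≤1
  ... | false = ≤-refl

  𝟙-≤-1 : ∀ X x → 𝟙 G X x ≤ 1ℚ
  𝟙-≤-1 X x with X x
  ... | true  = ≤-refl
  ... | false = 0≤1

  𝟙-∧ : ∀ (X Y : Subset G) x → 𝟙 G (λ z → X z ∧ Y z) x ≡ 𝟙 G X x * 𝟙 G Y x
  𝟙-∧ X Y x with X x
  ... | true  = sym (*-identityˡ (𝟙 G Y x))
  ... | false = sym (*-zeroˡ (𝟙 G Y x))

  μ-nonNeg : ∀ X → 0ℚ ≤ μ G X
  μ-nonNeg X = 𝔼-nonNeg (𝟙-nonNeg X)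

  μ-pos : ∀ {X} → Nonempty G X → 0ℚ < μ G X
  μ-pos {X} (x , x∈X) = 𝔼-pos (𝟙-nonNeg X) x (subst (λ b → 0ℚ < (if b then 1ℚ else 0ℚ)) (sym x∈X) (positive⁻¹ 1ℚ))

  μ[]-of-⊆ : ∀ {X B} → _⊆_ G X B → μ[_] G B X ≡ μ G X * inv (μ G B)
  μ[]-of-⊆ {X} {B} X⊆B = cong (_* inv (μ G B)) (𝔼-cong λ x → cong (λ b → if b then 1ℚ else 0ℚ) (X∧B≡X x))
    where
    X∧B≡X : ∀ x → X x ∧ B x ≡ X x
    X∧B≡X x with X x in x∈X
    ... | true  = X⊆B x x∈X
    ... | false = refl

  μ[]-pos⇒μ≢0 : ∀ {X B} → _⊆_ G X B → 0ℚ < μ[_] G B X → μ G X ≢ 0ℚ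
  μ[]-pos⇒μ≢0 {X} {B} X⊆B 0<μ[B]X μX≡0 = <-irrefl (sym μ[B]X≡0) 0<μ[B]X
    where
    μ[B]X≡0 = trans (μ[]-of-⊆ X⊆B) (trans (cong (_* inv (μ G B)) μX≡0) (*-zeroˡ (inv (μ G B))))

  μ-≤-of-μ[] : ∀ {X B t} → _⊆_ G X B → μ G B ≢ 0ℚ → μ[_] G B X ≤ t → μ G X ≤ t * μ G B
  μ-≤-of-μ[] {X} {B} {t} X⊆B μB≢0 μ[B]X≤t = begin
    μ G X                          ≡⟨ *-identityʳ (μ G X) ⟨
    μ G X * 1ℚ                     ≡⟨ cong (μ G X *_) (trans (*-comm (inv (μ G B)) (μ G B)) (*-inv μB≢0)) ⟨
    μ G X * (inv (μ G B) * μ G B)  ≡⟨ *-assoc (μ G X) (inv (μ G B)) (μ G B) ⟨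
    μ G X * inv (μ G B) * μ G B    ≡⟨ cong (_* μ G B) (μ[]-of-⊆ X⊆B) ⟨
    μ[_] G B X * μ G B             ≤⟨ *-monoʳ-≤ (μ-nonNeg B) μ[B]X≤t ⟩
    t * μ G B                      ∎
    where open ≤-Reasoning

  ∘ᶜ-nonNeg : ∀ {u v} → (∀ y → 0ℚ ≤ u y) → (∀ y → 0ℚ ≤ v y) → ∀ x → 0ℚ ≤ _∘ᶜ_ G u v x
  ∘ᶜ-nonNeg 0≤u 0≤v x = 𝔼-nonNeg (λ y → *-nonNeg (0≤u y) (0≤v (x ⊕ y)))

  ∘ᶜ-≤ : ∀ {u v c} → (∀ y → 0ℚ ≤ u y) → (∀ y → v y ≤ c) → ∀ x → _∘ᶜ_ G u v x ≤ 𝔼 G u * c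
  ∘ᶜ-≤ {u} {c = c} 0≤u v≤c x =
    ≤-trans (𝔼-mono (λ y → *-monoˡ-≤ (0≤u y) (v≤c (x ⊕ y)))) (≤-reflexive (𝔼-*ʳ c u))

  𝔼-∘ᶜ : ∀ u v → 𝔼 G (_∘ᶜ_ G u v) ≡ 𝔼 G u * 𝔼 G v
  𝔼-∘ᶜ u v = begin
    𝔼 G (λ x → 𝔼 G (λ y → u y * v (x ⊕ y))) ≡⟨ 𝔼-comm (λ x y → u y * v (x ⊕ y)) ⟩
    𝔼 G (λ y → 𝔼 G (λ x → u y * v (x ⊕ y))) ≡⟨ 𝔼-cong (λ y → 𝔼-*ˡ (u y) (λ x → v (x ⊕ y))) ⟩
    𝔼 G (λ y → u y * 𝔼 G (λ x → v (x ⊕ y))) ≡⟨ 𝔼-cong (λ y → cong (u y *_) (v-translate y)) ⟩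
    𝔼 G (λ y → u y * 𝔼 G v)                 ≡⟨ 𝔼-*ʳ (𝔼 G v) u ⟩
    𝔼 G u * 𝔼 G v                           ∎
    where
    open ≡-Reasoning
    v-translate : ∀ y → 𝔼 G (λ x → v (x ⊕ y)) ≡ 𝔼 G v
    v-translate y = trans (𝔼-cong (λ x → cong v (comm x y))) (𝔼-translate y v)

  bal-nonNeg : ∀ X x → 0ℚ ≤ bal G X x
  bal-nonNeg X x = *-nonNeg (𝟙-nonNeg X x) (inv-nonNeg (μ-nonNeg X))

  bal-≤ : ∀ X x → bal G X x ≤ inv (μ G X)
  bal-≤ X x = ≤-trans (*-monoʳ-≤ (inv-nonNeg (μ-nonNeg X)) (𝟙-≤-1 X x)) (≤-reflexive (*-identityˡ _))

  𝔼-bal : ∀ X → μ G X ≢ 0ℚ → 𝔼 G (bal G X) ≡ 1ℚ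
  𝔼-bal X μX≢0 = trans (𝔼-*ʳ (inv (μ G X)) (𝟙 G X)) (*-inv μX≢0)

  bal∘bal : ∀ X Y x → _∘ᶜ_ G (bal G X) (bal G Y) x
                      ≡ (inv (μ G X) * inv (μ G Y)) * _∘ᶜ_ G (𝟙 G X) (𝟙 G Y) x
  bal∘bal X Y x = trans (𝔼-cong (λ y → regroup (𝟙 G X y) (inv (μ G X)) (𝟙 G Y (x ⊕ y)) (inv (μ G Y))))
                        (𝔼-*ˡ (inv (μ G X) * inv (μ G Y)) (λ y → 𝟙 G X y * 𝟙 G Y (x ⊕ y)))
    where
    regroup : ∀ a b c d → (a * b) * (c * d) ≡ (b * d) * (a * c)
    regroup = solve 4 (λ a b c d → (a :* b) :* (c :* d) := (b :* d) :* (a :* c)) refl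

  μ*μ*bal∘bal : ∀ X Y → μ G X ≢ 0ℚ → μ G Y ≢ 0ℚ → ∀ x →
                (μ G X * μ G Y) * _∘ᶜ_ G (bal G X) (bal G Y) x ≡ _∘ᶜ_ G (𝟙 G X) (𝟙 G Y) x
  μ*μ*bal∘bal X Y μX≢0 μY≢0 x = begin
    (μ G X * μ G Y) * _∘ᶜ_ G (bal G X) (bal G Y) x
      ≡⟨ cong ((μ G X * μ G Y) *_) (bal∘bal X Y x) ⟩
    (μ G X * μ G Y) * ((inv (μ G X) * inv (μ G Y)) * 𝟙X∘𝟙Y)
      ≡⟨ *-assoc (μ G X * μ G Y) _ 𝟙X∘𝟙Y ⟨
    ((μ G X * μ G Y) * (inv (μ G X) * inv (μ G Y))) * 𝟙X∘𝟙Y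
      ≡⟨ cong (_* 𝟙X∘𝟙Y) (*-interchange (μ G X) (μ G Y) _ _) ⟩
    ((μ G X * inv (μ G X)) * (μ G Y * inv (μ G Y))) * 𝟙X∘𝟙Y
      ≡⟨ cong₂ (λ a b → (a * b) * 𝟙X∘𝟙Y) (*-inv μX≢0) (*-inv μY≢0) ⟩
    (1ℚ * 1ℚ) * 𝟙X∘𝟙Y
      ≡⟨ *-identityˡ 𝟙X∘𝟙Y ⟩
    𝟙X∘𝟙Y ∎
    where
    open ≡-Reasoning
    𝟙X∘𝟙Y = _∘ᶜ_ G (𝟙 G X) (𝟙 G Y) x

  ⟪bal∘bal⟫ : ∀ X Y f → ⟪_,_⟫ G (_∘ᶜ_ G (bal G X) (bal G Y)) f
                        ≡ (inv (μ G X) * inv (μ G Y)) * ⟪_,_⟫ G (_∘ᶜ_ G (𝟙 G X) (𝟙 G Y)) f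
  ⟪bal∘bal⟫ X Y f =
    trans (𝔼-cong (λ x → trans (cong (_* f x) (bal∘bal X Y x)) (*-assoc ιXY (𝟙X∘𝟙Y x) (f x))))
          (𝔼-*ˡ ιXY (λ x → 𝟙X∘𝟙Y x * f x))
    where
    ιXY = inv (μ G X) * inv (μ G Y)
    𝟙X∘𝟙Y = _∘ᶜ_ G (𝟙 G X) (𝟙 G Y)

  ⟪bal∘bal⟫-≤ : ∀ X Y f {c} → μ G X ≢ 0ℚ → μ G Y ≢ 0ℚ →
                ⟪_,_⟫ G (_∘ᶜ_ G (𝟙 G X) (𝟙 G Y)) f ≤ c * (μ G X * μ G Y) →
                ⟪_,_⟫ G (_∘ᶜ_ G (bal G X) (bal G Y)) f ≤ c
  ⟪bal∘bal⟫-≤ X Y f {c} μX≢0 μY≢0 ⟪⟫≤cμμ = begin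
    ⟪_,_⟫ G (_∘ᶜ_ G (bal G X) (bal G Y)) f ≡⟨ ⟪bal∘bal⟫ X Y f ⟩
    (ιX * ιY) * ⟪_,_⟫ G (_∘ᶜ_ G (𝟙 G X) (𝟙 G Y)) f
      ≤⟨ *-monoˡ-≤ (*-nonNeg (inv-nonNeg (μ-nonNeg X)) (inv-nonNeg (μ-nonNeg Y))) ⟪⟫≤cμμ ⟩
    (ιX * ιY) * (c * (μ G X * μ G Y)) ≡⟨ regroup ιX ιY c (μ G X) (μ G Y) ⟩
    c * ((μ G X * ιX) * (μ G Y * ιY)) ≡⟨ cong₂ (λ a b → c * (a * b)) (*-inv μX≢0) (*-inv μY≢0) ⟩
    c * (1ℚ * 1ℚ)                     ≡⟨ *-identityʳ c ⟩
    c                                 ∎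
    where
    open ≤-Reasoning
    ιX = inv (μ G X)
    ιY = inv (μ G Y)
    regroup : ∀ i j c m n → (i * j) * (c * (m * n)) ≡ c * ((m * i) * (n * j))
    regroup = solve 5 (λ i j c m n → (i :* j) :* (c :* (m :* n)) := c :* ((m :* i) :* (n :* j))) refl

module TupleExpectation (G : FiniteAbelianGroup) where
  open import Data.Nat using (ℕ; zero; suc)
  open import Data.Vec using (Vec; []; _∷_)
  open import Data.Product using (∃; _×_; _,_)
  open import Data.Rational
  open import Data.Rational.Properties
  open import Relation.Binary.PropositionalEquality
  open RationalLemmas
  open Expectation G
  open FiniteAbelianGroup G

  𝔼ᵛ : ∀ n → (Vec Carrier n → ℚ) → ℚ
  𝔼ᵛ zero    h = h []
  𝔼ᵛ (suc n) h = 𝔼 G (λ t → 𝔼ᵛ n (λ s → h (t ∷ s)))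

  𝔼ᵛ-cong : ∀ n {h k : Vec Carrier n → ℚ} → h ≗ k → 𝔼ᵛ n h ≡ 𝔼ᵛ n k
  𝔼ᵛ-cong zero    h≗k = h≗k []
  𝔼ᵛ-cong (suc n) h≗k = 𝔼-cong (λ t → 𝔼ᵛ-cong n (λ s → h≗k (t ∷ s)))

  𝔼ᵛ-+ : ∀ n (h k : Vec Carrier n → ℚ) → 𝔼ᵛ n (λ s → h s + k s) ≡ 𝔼ᵛ n h + 𝔼ᵛ n k
  𝔼ᵛ-+ zero    h k = refl
  𝔼ᵛ-+ (suc n) h k = trans (𝔼-cong (λ t → 𝔼ᵛ-+ n (λ s → h (t ∷ s)) (λ s → k (t ∷ s))))
                           (𝔼-+ (λ t → 𝔼ᵛ n (λ s → h (t ∷ s))) (λ t → 𝔼ᵛ n (λ s → k (t ∷ s))))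

  𝔼ᵛ-*ˡ : ∀ n c (h : Vec Carrier n → ℚ) → 𝔼ᵛ n (λ s → c * h s) ≡ c * 𝔼ᵛ n h
  𝔼ᵛ-*ˡ zero    c h = refl
  𝔼ᵛ-*ˡ (suc n) c h = trans (𝔼-cong (λ t → 𝔼ᵛ-*ˡ n c (λ s → h (t ∷ s))))
                            (𝔼-*ˡ c (λ t → 𝔼ᵛ n (λ s → h (t ∷ s))))

  𝔼ᵛ-*ʳ : ∀ n c (h : Vec Carrier n → ℚ) → 𝔼ᵛ n (λ s → h s * c) ≡ 𝔼ᵛ n h * c
  𝔼ᵛ-*ʳ n c h = trans (𝔼ᵛ-cong n (λ s → *-comm (h s) c)) (trans (𝔼ᵛ-*ˡ n c h) (*-comm c (𝔼ᵛ n h)))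

  𝔼ᵛ-mono : ∀ n {h k : Vec Carrier n → ℚ} → (∀ s → h s ≤ k s) → 𝔼ᵛ n h ≤ 𝔼ᵛ n k
  𝔼ᵛ-mono zero    h≤k = h≤k []
  𝔼ᵛ-mono (suc n) h≤k = 𝔼-mono (λ t → 𝔼ᵛ-mono n (λ s → h≤k (t ∷ s)))

  𝔼ᵛ-nonNeg : ∀ n {h : Vec Carrier n → ℚ} → (∀ s → 0ℚ ≤ h s) → 0ℚ ≤ 𝔼ᵛ n h
  𝔼ᵛ-nonNeg zero    0≤h = 0≤h []
  𝔼ᵛ-nonNeg (suc n) 0≤h = 𝔼-nonNeg (λ t → 𝔼ᵛ-nonNeg n (λ s → 0≤h (t ∷ s)))

  𝔼ᵛ-comm : ∀ n (h : Vec Carrier n → Carrier → ℚ) →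
            𝔼ᵛ n (λ s → 𝔼 G (h s)) ≡ 𝔼 G (λ x → 𝔼ᵛ n (λ s → h s x))
  𝔼ᵛ-comm zero    h = refl
  𝔼ᵛ-comm (suc n) h = trans (𝔼-cong (λ t → 𝔼ᵛ-comm n (λ s → h (t ∷ s))))
                            (𝔼-comm (λ t x → 𝔼ᵛ n (λ s → h (t ∷ s) x)))

  𝔼ᵛ-witness : ∀ n {c} (u w : Vec Carrier n → ℚ) → 0ℚ ≤ c → (∀ s → 0ℚ ≤ u s) →
               0ℚ < 𝔼ᵛ n w → 𝔼ᵛ n u ≤ c * 𝔼ᵛ n w → ∃ λ s → 0ℚ < w s × u s ≤ c * w s
  𝔼ᵛ-witness zero    u w _   _   0<w u≤cw = [] , 0<w , u≤cw
  𝔼ᵛ-witness (suc n) u w 0≤c 0≤u 0<𝔼w 𝔼u≤c𝔼w =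
    let t , 0<wₜ , uₜ≤cwₜ = 𝔼-witness (λ t → 𝔼ᵛ n (λ s → u (t ∷ s))) (λ t → 𝔼ᵛ n (λ s → w (t ∷ s)))
                                       0≤c (λ t → 𝔼ᵛ-nonNeg n (λ s → 0≤u (t ∷ s))) 0<𝔼w 𝔼u≤c𝔼w
        s , found = 𝔼ᵛ-witness n (λ s → u (t ∷ s)) (λ s → w (t ∷ s)) 0≤c (λ s → 0≤u (t ∷ s)) 0<wₜ uₜ≤cwₜ
    in t ∷ s , found

  ∏ : ∀ {n} → (Carrier → ℚ) → Vec Carrier n → ℚ
  ∏ φ []      = 1ℚ
  ∏ φ (t ∷ s) = φ t * ∏ φ s

  ∏-* : ∀ {n} (φ ψ : Carrier → ℚ) (s : Vec Carrier n) → ∏ φ s * ∏ ψ s ≡ ∏ (λ t → φ t * ψ t) s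
  ∏-* φ ψ []      = *-identityˡ 1ℚ
  ∏-* φ ψ (t ∷ s) = trans (*-interchange (φ t) (∏ φ s) (ψ t) (∏ ψ s)) (cong (φ t * ψ t *_) (∏-* φ ψ s))

  𝔼ᵛ-∏ : ∀ n (φ : Carrier → ℚ) → 𝔼ᵛ n (∏ φ) ≡ 𝔼 G φ ^ n
  𝔼ᵛ-∏ zero    φ = refl
  𝔼ᵛ-∏ (suc n) φ = trans (𝔼-cong (λ t → trans (𝔼ᵛ-*ˡ n (φ t) (∏ φ)) (cong (φ t *_) (𝔼ᵛ-∏ n φ))))
                         (𝔼-*ʳ (𝔼 G φ ^ n) φ)

module DependentRandomChoice (G : FiniteAbelianGroup) (A : Subset G) where
  open import Data.Vec using (Vec; []; _∷_)
  open import Data.Bool using (true; _∧_)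
  open import Data.Bool.Properties using (∧-conicalˡ)
  open import Data.Rational
  open import Relation.Binary.PropositionalEquality
  open import Algebra.Structures using (IsAbelianGroup)
  open RationalLemmas
  open Expectation G
  open Densities G
  open TupleExpectation G
  open FiniteAbelianGroup G
  open IsAbelianGroup isAbelianGroup using (assoc)

  common : ∀ {n} → Vec Carrier n → Subset G
  common []      x = true
  common (t ∷ s) x = A (x ⊕ t) ∧ common s x

  select : ∀ {n} → Subset G → Vec Carrier n → Subset G
  select B s x = B x ∧ common s x

  select-⊆ : ∀ {n} B (s : Vec Carrier n) → _⊆_ G (select B s) B
  select-⊆ B s x = ∧-conicalˡ (B x) (common s x)

  𝟙-common : ∀ {n} (s : Vec Carrier n) x → 𝟙 G (common s) x ≡ ∏ (λ t → 𝟙 G A (x ⊕ t)) s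
  𝟙-common []      x = refl
  𝟙-common (t ∷ s) x = trans (𝟙-∧ (λ z → A (z ⊕ t)) (common s) x) (cong (𝟙 G A (x ⊕ t) *_) (𝟙-common s x))

  𝟙-select : ∀ {n} B (s : Vec Carrier n) x → 𝟙 G (select B s) x ≡ 𝟙 G B x * ∏ (λ t → 𝟙 G A (x ⊕ t)) s
  𝟙-select B s x = trans (𝟙-∧ B (common s) x) (cong (𝟙 G B x *_) (𝟙-common s x))

  𝔼ᵛ-μ-select : ∀ n B → 𝔼ᵛ n (λ s → μ G (select B s)) ≡ μ G B * μ G A ^ n
  𝔼ᵛ-μ-select n B = begin
    𝔼ᵛ n (λ s → 𝔼 G (𝟙 G (select B s)))        ≡⟨ 𝔼ᵛ-cong n (λ s → 𝔼-cong (𝟙-select B s)) ⟩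
    𝔼ᵛ n (λ s → 𝔼 G (λ y → 𝟙 G B y * A+ y s))  ≡⟨ 𝔼ᵛ-comm n (λ s y → 𝟙 G B y * A+ y s) ⟩
    𝔼 G (λ y → 𝔼ᵛ n (λ s → 𝟙 G B y * A+ y s))  ≡⟨ 𝔼-cong (λ y → 𝔼ᵛ-*ˡ n (𝟙 G B y) (A+ y)) ⟩
    𝔼 G (λ y → 𝟙 G B y * 𝔼ᵛ n (A+ y))          ≡⟨ 𝔼-cong (λ y → cong (𝟙 G B y *_) (𝔼ᵛ-A+ y)) ⟩
    𝔼 G (λ y → 𝟙 G B y * μ G A ^ n)            ≡⟨ 𝔼-*ʳ (μ G A ^ n) (𝟙 G B) ⟩
    μ G B * μ G A ^ n                          ∎
    where
    open ≡-Reasoning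
    A+ : Carrier → Vec Carrier n → ℚ
    A+ y = ∏ (λ t → 𝟙 G A (y ⊕ t))
    𝔼ᵛ-A+ : ∀ y → 𝔼ᵛ n (A+ y) ≡ μ G A ^ n
    𝔼ᵛ-A+ y = trans (𝔼ᵛ-∏ n (λ t → 𝟙 G A (y ⊕ t))) (cong (_^ n) (𝔼-translate y (𝟙 G A)))

  𝔼ᵛ-𝟙select-pair : ∀ n B₁ B₂ x y →
    𝔼ᵛ n (λ s → 𝟙 G (select B₁ s) y * 𝟙 G (select B₂ s) (x ⊕ y))
    ≡ (𝟙 G B₁ y * 𝟙 G B₂ (x ⊕ y)) * _∘ᶜ_ G (𝟙 G A) (𝟙 G A) x ^ n
  𝔼ᵛ-𝟙select-pair n B₁ B₂ x y = begin
    𝔼ᵛ n (λ s → 𝟙 G (select B₁ s) y * 𝟙 G (select B₂ s) (x ⊕ y))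
      ≡⟨ 𝔼ᵛ-cong n (λ s → cong₂ _*_ (𝟙-select B₁ s y) (𝟙-select B₂ s (x ⊕ y))) ⟩
    𝔼ᵛ n (λ s → (𝟙 G B₁ y * ∏ φ₁ s) * (𝟙 G B₂ (x ⊕ y) * ∏ φ₂ s))
      ≡⟨ 𝔼ᵛ-cong n (λ s → trans (*-interchange (𝟙 G B₁ y) (∏ φ₁ s) (𝟙 G B₂ (x ⊕ y)) (∏ φ₂ s))
                                 (cong (b *_) (∏-* φ₁ φ₂ s))) ⟩
    𝔼ᵛ n (λ s → b * ∏ (λ t → φ₁ t * φ₂ t) s)
      ≡⟨ 𝔼ᵛ-*ˡ n b (∏ (λ t → φ₁ t * φ₂ t)) ⟩
    b * 𝔼ᵛ n (∏ (λ t → φ₁ t * φ₂ t))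
      ≡⟨ cong (b *_) (trans (𝔼ᵛ-∏ n _) (cong (_^ n) 𝔼φ₁φ₂)) ⟩
    b * _∘ᶜ_ G (𝟙 G A) (𝟙 G A) x ^ n ∎
    where
    open ≡-Reasoning
    b = 𝟙 G B₁ y * 𝟙 G B₂ (x ⊕ y)
    φ₁ φ₂ : Carrier → ℚ
    φ₁ t = 𝟙 G A (y ⊕ t)
    φ₂ t = 𝟙 G A ((x ⊕ y) ⊕ t)
    𝔼φ₁φ₂ : 𝔼 G (λ t → φ₁ t * φ₂ t) ≡ _∘ᶜ_ G (𝟙 G A) (𝟙 G A) x
    𝔼φ₁φ₂ = trans (𝔼-cong (λ t → cong (λ z → φ₁ t * 𝟙 G A z) (assoc x y t)))
                  (𝔼-translate y (λ t → 𝟙 G A t * 𝟙 G A (x ⊕ t)))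

  𝔼ᵛ-⟪select∘select⟫ : ∀ n B₁ B₂ f →
    𝔼ᵛ n (λ s → ⟪_,_⟫ G (_∘ᶜ_ G (𝟙 G (select B₁ s)) (𝟙 G (select B₂ s))) f)
    ≡ ⟪_,_⟫ G (λ x → _∘ᶜ_ G (𝟙 G B₁) (𝟙 G B₂) x * _∘ᶜ_ G (𝟙 G A) (𝟙 G A) x ^ n) f
  𝔼ᵛ-⟪select∘select⟫ n B₁ B₂ f = begin
    𝔼ᵛ n (λ s → 𝔼 G (λ x → 𝔼 G (pair s x) * f x))
      ≡⟨ 𝔼ᵛ-comm n (λ s x → 𝔼 G (pair s x) * f x) ⟩
    𝔼 G (λ x → 𝔼ᵛ n (λ s → 𝔼 G (pair s x) * f x))
      ≡⟨ 𝔼-cong (λ x → 𝔼ᵛ-*ʳ n (f x) (λ s → 𝔼 G (pair s x))) ⟩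
    𝔼 G (λ x → 𝔼ᵛ n (λ s → 𝔼 G (pair s x)) * f x)
      ≡⟨ 𝔼-cong (λ x → cong (_* f x) (trans (𝔼ᵛ-comm n (λ s → pair s x)) (𝔼-cong (𝔼ᵛ-𝟙select-pair n B₁ B₂ x)))) ⟩
    𝔼 G (λ x → 𝔼 G (λ y → (𝟙 G B₁ y * 𝟙 G B₂ (x ⊕ y)) * cA x ^ n) * f x)
      ≡⟨ 𝔼-cong (λ x → cong (_* f x) (𝔼-*ʳ (cA x ^ n) (λ y → 𝟙 G B₁ y * 𝟙 G B₂ (x ⊕ y)))) ⟩
    𝔼 G (λ x → (_∘ᶜ_ G (𝟙 G B₁) (𝟙 G B₂) x * cA x ^ n) * f x) ∎
    where
    open ≡-Reasoning
    cA = _∘ᶜ_ G (𝟙 G A) (𝟙 G A)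
    pair : Vec Carrier n → Carrier → Carrier → ℚ
    pair s x y = 𝟙 G (select B₁ s) y * 𝟙 G (select B₂ s) (x ⊕ y)

module Choice (G : FiniteAbelianGroup) (p : ℕ) (B₁ B₂ A : Subset G)
              (f : FiniteAbelianGroup.Carrier G → ℚ) (B₁≢∅ : Nonempty G B₁) (B₂≢∅ : Nonempty G B₂)
              (0<α : 0ℚ Q.< μ G A) (0≤f : ∀ x → 0ℚ Q.≤ f x) where
  open import Data.Nat as ℕ using (ℕ)
  open import Data.Bool using (false)
  open import Data.Integer using (+_)
  open import Data.Vec using (Vec)
  open import Data.Product using (∃; _×_; _,_)
  open import Data.Sum using (_⊎_; inj₁; inj₂)
  open import Data.Rational
  open import Data.Rational.Properties
  open import Data.Rational.Solver using (module +-*-Solver)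
  open import Data.Empty using (⊥-elim)
  open import Relation.Binary.PropositionalEquality
  open import Relation.Nullary using (¬_; Dec; yes; no)
  open +-*-Solver using (solve; con; _:+_; _:*_; _:=_)
  open RationalLemmas
  open Expectation G
  open Densities G
  open TupleExpectation G
  open DependentRandomChoice G A
  open FiniteAbelianGroup G using (Carrier)

  α : ℚ
  α = μ G A

  μB g : Carrier → ℚ
  μB = _∘ᶜ_ G (bal G B₁) (bal G B₂)
  g  = _∘ᶜ_ G (bal G A) (bal G A)

  2ℚ N R K η c : ℚ
  2ℚ = (+ 2) / 1
  N = normPow G p μB g
  R = ⟪_,_⟫[_] G (λ x → g x ^ p) f μB
  K = (μ G B₁ * μ G B₂) * (α * α) ^ p
  η = ((+ 1) / 4) * (α ^ (2 ℕ.* p)) * (N ^ 2)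
  c = 2ℚ * (R * inv N)

  A₁ A₂ : Vec Carrier p → Subset G
  A₁ = select B₁
  A₂ = select B₂

  F W : Vec Carrier p → ℚ
  F s = ⟪_,_⟫ G (_∘ᶜ_ G (𝟙 G (A₁ s)) (𝟙 G (A₂ s))) f
  W s = μ G (A₁ s) * μ G (A₂ s)

  private
    pos⇒≢0 : ∀ {q} → 0ℚ < q → q ≢ 0ℚ
    pos⇒≢0 0<q q≡0 = <-irrefl (sym q≡0) 0<q

    μB₁≢0 = pos⇒≢0 (μ-pos B₁≢∅)
    μB₂≢0 = pos⇒≢0 (μ-pos B₂≢∅)
    α≢0   = pos⇒≢0 0<α

  0≤μB : ∀ x → 0ℚ ≤ μB x
  0≤μB = ∘ᶜ-nonNeg (bal-nonNeg B₁) (bal-nonNeg B₂)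

  0≤g : ∀ x → 0ℚ ≤ g x
  0≤g = ∘ᶜ-nonNeg (bal-nonNeg A) (bal-nonNeg A)

  0≤N : 0ℚ ≤ N
  0≤N = 𝔼-nonNeg (λ x → *-nonNeg (0≤μB x) (^-nonNeg p (0≤∣p∣ (g x))))

  0≤R : 0ℚ ≤ R
  0≤R = 𝔼-nonNeg (λ x → *-nonNeg (*-nonNeg (0≤μB x) (^-nonNeg p (0≤g x))) (0≤f x))

  0≤c : 0ℚ ≤ c
  0≤c = *-nonNeg (<⇒≤ (positive⁻¹ 2ℚ)) (*-nonNeg 0≤R (inv-nonNeg 0≤N))

  0<K : 0ℚ < K
  0<K = *-pos (*-pos (μ-pos B₁≢∅) (μ-pos B₂≢∅)) (^-pos p (*-pos 0<α 0<α))

  0≤F : ∀ s → 0ℚ ≤ F s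
  0≤F s = 𝔼-nonNeg (λ x → *-nonNeg (∘ᶜ-nonNeg (𝟙-nonNeg (A₁ s)) (𝟙-nonNeg (A₂ s)) x) (0≤f x))

  K*μB*gᵖ : ∀ x → K * (μB x * g x ^ p)
                  ≡ _∘ᶜ_ G (𝟙 G B₁) (𝟙 G B₂) x * _∘ᶜ_ G (𝟙 G A) (𝟙 G A) x ^ p
  K*μB*gᵖ x = begin
    (μ G B₁ * μ G B₂) * (α * α) ^ p * (μB x * g x ^ p)
      ≡⟨ *-interchange (μ G B₁ * μ G B₂) ((α * α) ^ p) (μB x) (g x ^ p) ⟩
    ((μ G B₁ * μ G B₂) * μB x) * ((α * α) ^ p * g x ^ p)
      ≡⟨ cong (((μ G B₁ * μ G B₂) * μB x) *_) (^-distrib-* (α * α) (g x) p) ⟨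
    ((μ G B₁ * μ G B₂) * μB x) * ((α * α) * g x) ^ p
      ≡⟨ cong₂ (λ u v → u * v ^ p) (μ*μ*bal∘bal B₁ B₂ μB₁≢0 μB₂≢0 x) (μ*μ*bal∘bal A A α≢0 α≢0 x) ⟩
    _∘ᶜ_ G (𝟙 G B₁) (𝟙 G B₂) x * _∘ᶜ_ G (𝟙 G A) (𝟙 G A) x ^ p ∎
    where open ≡-Reasoning

  𝔼ᵛ-⟪A₁∘A₂⟫ : ∀ h → 𝔼ᵛ p (λ s → ⟪_,_⟫ G (_∘ᶜ_ G (𝟙 G (A₁ s)) (𝟙 G (A₂ s))) h)
                     ≡ K * ⟪_,_⟫[_] G (λ x → g x ^ p) h μB
  𝔼ᵛ-⟪A₁∘A₂⟫ h =
    trans (𝔼ᵛ-⟪select∘select⟫ p B₁ B₂ h)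
          (trans (𝔼-cong (λ x → trans (cong (_* h x) (sym (K*μB*gᵖ x))) (*-assoc K _ (h x))))
                 (𝔼-*ˡ K (λ x → μB x * g x ^ p * h x)))

  𝔼ᵛF : 𝔼ᵛ p F ≡ K * R
  𝔼ᵛF = 𝔼ᵛ-⟪A₁∘A₂⟫ f

  𝔼ᵛW : 𝔼ᵛ p W ≡ K * N
  𝔼ᵛW = begin
    𝔼ᵛ p W
      ≡⟨ 𝔼ᵛ-cong p (λ s → trans (sym (𝔼-∘ᶜ (𝟙 G (A₁ s)) (𝟙 G (A₂ s))))
                                (𝔼-cong (λ x → sym (*-identityʳ (_∘ᶜ_ G (𝟙 G (A₁ s)) (𝟙 G (A₂ s)) x))))) ⟩
    𝔼ᵛ p (λ s → ⟪_,_⟫ G (_∘ᶜ_ G (𝟙 G (A₁ s)) (𝟙 G (A₂ s))) (λ _ → 1ℚ))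
      ≡⟨ 𝔼ᵛ-⟪A₁∘A₂⟫ (λ _ → 1ℚ) ⟩
    K * ⟪_,_⟫[_] G (λ x → g x ^ p) (λ _ → 1ℚ) μB
      ≡⟨ cong (K *_) (𝔼-cong (λ x → trans (*-identityʳ (μB x * g x ^ p))
                                             (cong (λ y → μB x * y ^ p) (sym (0≤p⇒∣p∣≡p (0≤g x)))))) ⟩
    K * N ∎
    where open ≡-Reasoning

  αg≤1 : ∀ x → α * g x ≤ 1ℚ
  αg≤1 x = begin
    α * g x                      ≤⟨ *-monoˡ-≤ (<⇒≤ 0<α) (∘ᶜ-≤ (bal-nonNeg A) (bal-≤ A) x) ⟩
    α * (𝔼 G (bal G A) * inv α)  ≡⟨ cong (λ e → α * (e * inv α)) (𝔼-bal A α≢0) ⟩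
    α * (1ℚ * inv α)             ≡⟨ cong (α *_) (*-identityˡ (inv α)) ⟩
    α * inv α                    ≡⟨ *-inv α≢0 ⟩
    1ℚ                           ∎
    where open ≤-Reasoning

  αᵖN≤1 : α ^ p * N ≤ 1ℚ
  αᵖN≤1 = begin
    α ^ p * N                                   ≡⟨ 𝔼-*ˡ (α ^ p) (λ x → μB x * ∣ g x ∣ ^ p) ⟨
    𝔼 G (λ x → α ^ p * (μB x * ∣ g x ∣ ^ p))    ≡⟨ 𝔼-cong regroup ⟩
    𝔼 G (λ x → μB x * (α * g x) ^ p)            ≤⟨ 𝔼-mono (λ x → *-monoˡ-≤ (0≤μB x) (^-≤-1 p (0≤αg x) (αg≤1 x))) ⟩
    𝔼 G (λ x → μB x * 1ℚ)                       ≡⟨ 𝔼-cong (λ x → *-identityʳ (μB x)) ⟩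
    𝔼 G μB                                      ≡⟨ 𝔼-∘ᶜ (bal G B₁) (bal G B₂) ⟩
    𝔼 G (bal G B₁) * 𝔼 G (bal G B₂)             ≡⟨ cong₂ _*_ (𝔼-bal B₁ μB₁≢0) (𝔼-bal B₂ μB₂≢0) ⟩
    1ℚ                                          ∎
    where
    open ≤-Reasoning
    0≤αg : ∀ x → 0ℚ ≤ α * g x
    0≤αg x = *-nonNeg (<⇒≤ 0<α) (0≤g x)
    regroup : ∀ x → α ^ p * (μB x * ∣ g x ∣ ^ p) ≡ μB x * (α * g x) ^ p
    regroup x = begin-equality
      α ^ p * (μB x * ∣ g x ∣ ^ p) ≡⟨ cong (λ y → α ^ p * (μB x * y ^ p)) (0≤p⇒∣p∣≡p (0≤g x)) ⟩
      α ^ p * (μB x * g x ^ p)     ≡⟨ solve 3 (λ a m h → a :* (m :* h) := m :* (a :* h)) refl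
                                              (α ^ p) (μB x) (g x ^ p) ⟩
      μB x * (α ^ p * g x ^ p)     ≡⟨ cong (μB x *_) (^-distrib-* α (g x) p) ⟨
      μB x * (α * g x) ^ p         ∎

  Good : Vec Carrier p → Set
  Good s = η ≤ μ[_] G B₁ (A₁ s) ⊓ μ[_] G B₂ (A₂ s)

  good? : ∀ s → Dec (Good s)
  good? s = η ≤? μ[_] G B₁ (A₁ s) ⊓ μ[_] G B₂ (A₂ s)

  keep : ∀ {P : Set} → Dec P → ℚ → ℚ
  keep (yes _) q = q
  keep (no _)  _ = 0ℚ

  keep-nonNeg : ∀ {P : Set} (d : Dec P) {q} → 0ℚ ≤ q → 0ℚ ≤ keep d q
  keep-nonNeg (yes _) 0≤q = 0≤q
  keep-nonNeg (no _)  _   = ≤-refl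

  keep-≤ : ∀ {P : Set} (d : Dec P) {q} → 0ℚ ≤ q → keep d q ≤ q
  keep-≤ (yes _) _   = ≤-refl
  keep-≤ (no _)  0≤q = 0≤q

  onGood : (Vec Carrier p → ℚ) → Vec Carrier p → ℚ
  onGood h s = keep (good? s) (h s)

  bad : Vec Carrier p → ℚ
  bad s = η * (μ G B₁ * μ G (A₂ s) + μ G B₂ * μ G (A₁ s))

  0≤η : 0ℚ ≤ η
  0≤η = *-nonNeg (*-nonNeg (<⇒≤ (positive⁻¹ ((+ 1) / 4))) (^-nonNeg (2 ℕ.* p) (<⇒≤ 0<α))) (^-nonNeg 2 0≤N)

  0≤bad : ∀ s → 0ℚ ≤ bad s
  0≤bad s = *-nonNeg 0≤η (+-mono-≤ (*-nonNeg (μ-nonNeg B₁) (μ-nonNeg (A₂ s)))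
                                   (*-nonNeg (μ-nonNeg B₂) (μ-nonNeg (A₁ s))))

  ¬Good⇒thin : ∀ s → ¬ Good s → μ[_] G B₁ (A₁ s) ≤ η ⊎ μ[_] G B₂ (A₂ s) ≤ η
  ¬Good⇒thin s ¬good with η ≤? μ[_] G B₁ (A₁ s)
  ... | no  η≰D₁ = inj₁ (<⇒≤ (≰⇒> η≰D₁))
  ... | yes η≤D₁ = inj₂ (<⇒≤ (≰⇒> λ η≤D₂ → ¬good (⊓-glb η≤D₁ η≤D₂)))

  W≤bad : ∀ s → μ[_] G B₁ (A₁ s) ≤ η ⊎ μ[_] G B₂ (A₂ s) ≤ η → W s ≤ bad s
  W≤bad s (inj₁ D₁≤η) = begin
    μ G (A₁ s) * μ G (A₂ s)    ≤⟨ *-monoʳ-≤ (μ-nonNeg (A₂ s)) (μ-≤-of-μ[] (select-⊆ B₁ s) μB₁≢0 D₁≤η) ⟩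
    η * μ G B₁ * μ G (A₂ s)    ≡⟨ *-assoc η (μ G B₁) (μ G (A₂ s)) ⟩
    η * (μ G B₁ * μ G (A₂ s))  ≤⟨ *-monoˡ-≤ 0≤η (p≤p+q (*-nonNeg (μ-nonNeg B₂) (μ-nonNeg (A₁ s)))) ⟩
    bad s                      ∎
    where open ≤-Reasoning
  W≤bad s (inj₂ D₂≤η) = begin
    μ G (A₁ s) * μ G (A₂ s)    ≤⟨ *-monoˡ-≤ (μ-nonNeg (A₁ s)) (μ-≤-of-μ[] (select-⊆ B₂ s) μB₂≢0 D₂≤η) ⟩
    μ G (A₁ s) * (η * μ G B₂)  ≡⟨ solve 3 (λ a e b → a :* (e :* b) := e :* (b :* a)) refl (μ G (A₁ s)) η (μ G B₂) ⟩
    η * (μ G B₂ * μ G (A₁ s))  ≤⟨ *-monoˡ-≤ 0≤η (p≤q+p (*-nonNeg (μ-nonNeg B₁) (μ-nonNeg (A₂ s)))) ⟩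
    bad s                      ∎
    where open ≤-Reasoning

  W≤onGood+bad : ∀ s → W s ≤ onGood W s + bad s
  W≤onGood+bad s = split (good? s)
    where
    split : (good : Dec (Good s)) → W s ≤ keep good (W s) + bad s
    split (yes _)    = p≤p+q (0≤bad s)
    split (no ¬good) = ≤-trans (W≤bad s (¬Good⇒thin s ¬good)) (≤-reflexive (sym (+-identityˡ (bad s))))

  𝔼ᵛbad : 𝔼ᵛ p bad ≡ η * (μ G B₁ * (μ G B₂ * α ^ p) + μ G B₂ * (μ G B₁ * α ^ p))
  𝔼ᵛbad = begin
    𝔼ᵛ p bad
      ≡⟨ 𝔼ᵛ-*ˡ p η (λ s → μ G B₁ * μ G (A₂ s) + μ G B₂ * μ G (A₁ s)) ⟩
    η * 𝔼ᵛ p (λ s → μ G B₁ * μ G (A₂ s) + μ G B₂ * μ G (A₁ s))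
      ≡⟨ cong (η *_) (𝔼ᵛ-+ p (λ s → μ G B₁ * μ G (A₂ s)) (λ s → μ G B₂ * μ G (A₁ s))) ⟩
    η * (𝔼ᵛ p (λ s → μ G B₁ * μ G (A₂ s)) + 𝔼ᵛ p (λ s → μ G B₂ * μ G (A₁ s)))
      ≡⟨ cong (η *_) (cong₂ _+_ (mean B₁ B₂) (mean B₂ B₁)) ⟩
    η * (μ G B₁ * (μ G B₂ * α ^ p) + μ G B₂ * (μ G B₁ * α ^ p)) ∎
    where
    open ≡-Reasoning
    mean : ∀ B B′ → 𝔼ᵛ p (λ s → μ G B * μ G (select B′ s)) ≡ μ G B * (μ G B′ * α ^ p)
    mean B B′ = trans (𝔼ᵛ-*ˡ p (μ G B) (λ s → μ G (select B′ s))) (cong (μ G B *_) (𝔼ᵛ-μ-select p B′))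

  2𝔼ᵛbad≤KN : 2ℚ * 𝔼ᵛ p bad ≤ K * N
  2𝔼ᵛbad≤KN = begin
    2ℚ * 𝔼ᵛ p bad
      ≡⟨ cong (2ℚ *_) 𝔼ᵛbad ⟩
    2ℚ * ((¼ * α ^ (2 ℕ.* p) * N ^ 2) * (m₁ * (m₂ * α ^ p) + m₂ * (m₁ * α ^ p)))
      ≡⟨ cong (λ a → 2ℚ * ((¼ * a * N ^ 2) * (m₁ * (m₂ * α ^ p) + m₂ * (m₁ * α ^ p)))) (^-double α p) ⟩
    2ℚ * ((¼ * (α * α) ^ p * (N * (N * 1ℚ))) * (m₁ * (m₂ * α ^ p) + m₂ * (m₁ * α ^ p)))
      ≡⟨ solve 5 (λ a² aᵖ n u v →
           con 2ℚ :* ((con ¼ :* a² :* (n :* (n :* con 1ℚ))) :* (u :* (v :* aᵖ) :+ v :* (u :* aᵖ)))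
           := ((u :* v) :* a² :* n) :* (aᵖ :* n)) refl ((α * α) ^ p) (α ^ p) N m₁ m₂ ⟩
    (K * N) * (α ^ p * N)
      ≤⟨ *-monoˡ-≤ (*-nonNeg (<⇒≤ 0<K) 0≤N) αᵖN≤1 ⟩
    (K * N) * 1ℚ
      ≡⟨ *-identityʳ (K * N) ⟩
    K * N ∎
    where
    open ≤-Reasoning
    ¼ = (+ 1) / 4
    m₁ = μ G B₁
    m₂ = μ G B₂

  KN≤2𝔼ᵛonGoodW : K * N ≤ 2ℚ * 𝔼ᵛ p (onGood W)
  KN≤2𝔼ᵛonGoodW = +-cancel-≤ 2KN≤ 2𝔼ᵛbad≤KN
    where
    open ≤-Reasoning
    2KN≤ : K * N + K * N ≤ 2ℚ * 𝔼ᵛ p bad + 2ℚ * 𝔼ᵛ p (onGood W)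
    2KN≤ = begin
      K * N + K * N                          ≡⟨ solve 1 (λ x → x :+ x := con 2ℚ :* x) refl (K * N) ⟩
      2ℚ * (K * N)                           ≡⟨ cong (2ℚ *_) 𝔼ᵛW ⟨
      2ℚ * 𝔼ᵛ p W                            ≤⟨ *-monoˡ-≤ (<⇒≤ (positive⁻¹ 2ℚ)) (𝔼ᵛ-mono p W≤onGood+bad) ⟩
      2ℚ * 𝔼ᵛ p (λ s → onGood W s + bad s)   ≡⟨ cong (2ℚ *_) (𝔼ᵛ-+ p (onGood W) bad) ⟩
      2ℚ * (𝔼ᵛ p (onGood W) + 𝔼ᵛ p bad)      ≡⟨ solve 2 (λ x y → con 2ℚ :* (x :+ y) := con 2ℚ :* y :+ con 2ℚ :* x)
                                                       refl (𝔼ᵛ p (onGood W)) (𝔼ᵛ p bad) ⟩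
      2ℚ * 𝔼ᵛ p bad + 2ℚ * 𝔼ᵛ p (onGood W)   ∎

  Admissible : Subset G → Subset G → Set
  Admissible A₁ A₂ = _⊆_ G A₁ B₁ × _⊆_ G A₂ B₂ ×
                     ⟪_,_⟫ G (_∘ᶜ_ G (bal G A₁) (bal G A₂)) f ≤ c × η ≤ μ[_] G B₁ A₁ ⊓ μ[_] G B₂ A₂

  module _ (N≢0 : N ≢ 0ℚ) where
    0<N : 0ℚ < N
    0<N = ≰⇒> λ N≤0 → N≢0 (≤-antisym N≤0 0≤N)

    0<𝔼ᵛonGoodW : 0ℚ < 𝔼ᵛ p (onGood W)
    0<𝔼ᵛonGoodW = *-cancelˡ-<-nonNeg 2ℚ (begin-strict
      2ℚ * 0ℚ                 ≡⟨ *-zeroʳ 2ℚ ⟩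
      0ℚ                      <⟨ *-pos 0<K 0<N ⟩
      K * N                   ≤⟨ KN≤2𝔼ᵛonGoodW ⟩
      2ℚ * 𝔼ᵛ p (onGood W)    ∎)
      where open ≤-Reasoning

    𝔼ᵛonGoodF≤c𝔼ᵛonGoodW : 𝔼ᵛ p (onGood F) ≤ c * 𝔼ᵛ p (onGood W)
    𝔼ᵛonGoodF≤c𝔼ᵛonGoodW = begin
      𝔼ᵛ p (onGood F)                       ≤⟨ 𝔼ᵛ-mono p (λ s → keep-≤ (good? s) (0≤F s)) ⟩
      𝔼ᵛ p F                                ≡⟨ 𝔼ᵛF ⟩
      K * R                                 ≡⟨ KR≡ ⟩
      (R * inv N) * (K * N)                 ≤⟨ *-monoˡ-≤ (*-nonNeg 0≤R (inv-nonNeg 0≤N)) KN≤2𝔼ᵛonGoodW ⟩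
      (R * inv N) * (2ℚ * 𝔼ᵛ p (onGood W))  ≡⟨ solve 3 (λ r t e → r :* (t :* e) := (t :* r) :* e) refl
                                                       (R * inv N) 2ℚ (𝔼ᵛ p (onGood W)) ⟩
      c * 𝔼ᵛ p (onGood W)                   ∎
      where
      open ≤-Reasoning
      KR≡ : K * R ≡ (R * inv N) * (K * N)
      KR≡ = begin-equality
        K * R                   ≡⟨ *-identityʳ (K * R) ⟨
        (K * R) * 1ℚ            ≡⟨ cong ((K * R) *_) (*-inv N≢0) ⟨
        (K * R) * (N * inv N)   ≡⟨ solve 4 (λ k r n i → (k :* r) :* (n :* i) := (r :* i) :* (k :* n)) refl
                                           K R N (inv N) ⟩
        (R * inv N) * (K * N)   ∎

    selection-admissible : ∃ λ s → Admissible (A₁ s) (A₂ s)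
    selection-admissible =
      let s , 0<onGoodW , onGoodF≤ = 𝔼ᵛ-witness p (onGood F) (onGood W) 0≤c (λ s → keep-nonNeg (good? s) (0≤F s))
                                                 0<𝔼ᵛonGoodW 𝔼ᵛonGoodF≤c𝔼ᵛonGoodW
      in s , admissible s (good? s) 0<onGoodW onGoodF≤
      where
      admissible : ∀ s (good : Dec (Good s)) → 0ℚ < keep good (W s) → keep good (F s) ≤ c * keep good (W s) →
                   Admissible (A₁ s) (A₂ s)
      admissible s (yes good) _ F≤cW =
        select-⊆ B₁ s , select-⊆ B₂ s , ⟪bal∘bal⟫-≤ (A₁ s) (A₂ s) f μA₁≢0 μA₂≢0 F≤cW , good
        where
        D₁ D₂ : ℚ
        D₁ = μ[_] G B₁ (A₁ s)
        D₂ = μ[_] G B₂ (A₂ s)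
        0<η : 0ℚ < η
        0<η = *-pos (*-pos (positive⁻¹ ((+ 1) / 4)) (^-pos (2 ℕ.* p) 0<α)) (^-pos 2 0<N)
        μA₁≢0 = μ[]-pos⇒μ≢0 (select-⊆ B₁ s) (<-≤-trans 0<η (≤-trans good (p⊓q≤p D₁ D₂)))
        μA₂≢0 = μ[]-pos⇒μ≢0 (select-⊆ B₂ s) (<-≤-trans 0<η (≤-trans good (p⊓q≤q D₁ D₂)))
      admissible s (no _) 0<0 _ = ⊥-elim (<-irrefl refl 0<0)

  ∅ : Subset G
  ∅ _ = false

  -- For ‖g‖ᵖ = 0 both bounds degenerate to 0 (with inv 0 = 0), which the empty sets meet.
  ∅-admissible : N ≡ 0ℚ → Admissible ∅ ∅
  ∅-admissible N≡0 = (λ _ ()) , (λ _ ()) , ≤-reflexive (trans ⟪⟫≡0 (sym c≡0)) , ⊓-glb (η≤μ[]∅ B₁) (η≤μ[]∅ B₂)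
    where
    ⟪⟫≡0 : ⟪_,_⟫ G (_∘ᶜ_ G (bal G ∅) (bal G ∅)) f ≡ 0ℚ
    ⟪⟫≡0 = trans (⟪bal∘bal⟫ ∅ ∅ f)
                 (trans (cong (λ m → (inv m * inv m) * ⟪_,_⟫ G (_∘ᶜ_ G (𝟙 G ∅) (𝟙 G ∅)) f) 𝔼-0)
                        (*-zeroˡ (⟪_,_⟫ G (_∘ᶜ_ G (𝟙 G ∅) (𝟙 G ∅)) f)))
    c≡0 : c ≡ 0ℚ
    c≡0 = trans (cong (λ n → 2ℚ * (R * inv n)) N≡0) (trans (cong (2ℚ *_) (*-zeroʳ R)) (*-zeroʳ 2ℚ))
    η≡0 : η ≡ 0ℚ
    η≡0 = trans (cong (λ n → ((+ 1) / 4) * (α ^ (2 ℕ.* p)) * (n * (n * 1ℚ))) N≡0)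
                (*-zeroʳ (((+ 1) / 4) * (α ^ (2 ℕ.* p))))
    η≤μ[]∅ : ∀ B → η ≤ μ[_] G B ∅
    η≤μ[]∅ B = ≤-reflexive (trans η≡0 (sym (trans (cong (_* inv (μ G B)) 𝔼-0) (*-zeroˡ (inv (μ G B))))))

open import Data.Nat using (ℕ; _≤_)
import Data.Nat
open import Data.Nat.Divisibility using (_∣_)
open import Data.Product using (Σ; _×_; _,_)
open import Data.Rational using (ℚ; 0ℚ; _<_; _*_; _⊓_; _/_)
open import Data.Rational.Properties using (_≟_)
open import Data.Integer using (+_)
open import Relation.Nullary using (Dec; yes; no)
open import Relation.Binary.PropositionalEquality using (_≡_)

lemma9 : (G : FiniteAbelianGroup) → (p : ℕ) → 2 ≤ p → 2 ∣ p →
  (B₁ B₂ : Subset G) → Nonempty G B₁ → Nonempty G B₂ →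
  (A : Subset G) → 0ℚ < μ G A →
  (f : FiniteAbelianGroup.Carrier G → ℚ) →
  (∀ x → 0ℚ Q.≤ f x) →
  let μB = _∘ᶜ_ G (bal G B₁) (bal G B₂)
      g  = _∘ᶜ_ G (bal G A) (bal G A)
      N  = normPow G p μB g
  in Σ (Subset G) λ A₁ → Σ (Subset G) λ A₂ →
       _⊆_ G A₁ B₁ × _⊆_ G A₂ B₂ ×
       (⟪_,_⟫ G (_∘ᶜ_ G (bal G A₁) (bal G A₂)) f
          Q.≤ ((+ 2) / 1) * (⟪_,_⟫[_] G (λ x → g x ^ p) f μB * inv N)) ×
       (((+ 1) / 4) * (μ G A ^ (2 Data.Nat.* p)) * (N ^ 2)
          Q.≤ (μ[_] G B₁ A₁ ⊓ μ[_] G B₂ A₂))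
lemma9 G p _ _ B₁ B₂ B₁≢∅ B₂≢∅ A 0<α f 0≤f = admissible-pair (N ≟ 0ℚ)
  where
  open Choice G p B₁ B₂ A f B₁≢∅ B₂≢∅ 0<α 0≤f
  admissible-pair : Dec (N ≡ 0ℚ) → Σ (Subset G) λ A₁ → Σ (Subset G) (Admissible A₁)
  admissible-pair (yes N≡0) = ∅ , ∅ , ∅-admissible N≡0
  admissible-pair (no N≢0)  = let s , adm = selection-admissible N≢0 in A₁ s , A₂ s , adm
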